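{- Let $\mathbf{J}=\operatorname{Diag}(\mathbf{I}_p,-\mathbf{I}_{n-p})\in\mathbb{R}^{n\times n}$, $\mathcal{J}=\{\mathbf{X}\in\mathbb{R}^{n\times n}:\mathbf{X}^{\top}\mathbf{J}\mathbf{X}=\mathbf{J}\}$, and let $f:\mathbb{R}^{n\times n}\to\mathbb{R}$ be differentiable. Consider $\min_{\mathbf{X}\in\mathcal{J}}f(\mathbf{X})$. Then: (a) a point $\check{\mathbf{X}}\in\mathcal{J}$ is a critical point if and only if $\mathbf{0}=\nabla_{\mathcal{J}}f(\check{\mathbf{X}})\triangleq\nabla f(\check{\mathbf{X}})-\mathbf{J}\check{\mathbf{X}}[\nabla f(\check{\mathbf{X}})]^{\top}\check{\mathbf{X}}\mathbf{J}$, and the associated Lagrange multiplier is $\Lambda=\mathbf{J}\check{\mathbf{X}}^{\top}\nabla f(\check{\mathbf{X}})$; (b) for $\check{\mathbf{X}}\in\mathcal{J}$, this critical point condition is equivalent to the symmetry of the matrix $\check{\mathbf{X}}\mathbf{G}^{\top}\mathbf{J}$ where $\mathbf{G}=\nabla f(\check{\mathbf{X}})$, i.e. $\check{\mathbf{X}}\mathbf{G}^{\top}\mathbf{J}=[\check{\mathbf{X}}\mathbf{G}^{\top}\mathbf{J}]^{\top}$.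
   Context: The Lagrangian is $\mathcal{L}(\mathbf{X},\Lambda)=f(\mathbf{X})-\tfrac12\langle\Lambda,\mathbf{X}^{\top}\mathbf{J}\mathbf{X}-\mathbf{J}\rangle$ with $\Lambda$ symmetric. A point $\check{\mathbf{X}}\in\mathcal{J}$ is called a critical point if there is a symmetric $\Lambda\in\mathbb{R}^{n\times n}$ with $\nabla_{\mathbf{X}}\mathcal{L}(\check{\mathbf{X}},\Lambda)=\nabla f(\check{\mathbf{X}})-\mathbf{J}\check{\mathbf{X}}\Lambda=\mathbf{0}$. -}

module Defs where

open import Level using (_⊔_)
open import Data.Nat using (ℕ; zero; suc; _<_; _<?_)
open import Data.Fin using (Fin; toℕ; _≟_)
open import Data.Product using (Σ; _×_)
open import Relation.Nullary using (does)
open import Data.Bool using (if_then_else_)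
open import Algebra.Bundles using (CommutativeRing)

-- Square n×n matrices over a commutative ring R (standing in for ℝ),
-- represented as functions Fin n → Fin n → Carrier.
module MatrixOps {c ℓ} (R : CommutativeRing c ℓ) where
  open CommutativeRing R

  Mat : ℕ → Set c
  Mat n = Fin n → Fin n → Carrier

  Σ[<_] : ∀ n → (Fin n → Carrier) → Carrier
  Σ[< zero ] v = 0#
  Σ[< suc n ] v = v Fin.zero + Σ[< n ] (λ k → v (Fin.suc k))

  _ᵀ : ∀ {n} → Mat n → Mat n
  (A ᵀ) i j = A j i

  _⊗_ : ∀ {n} → Mat n → Mat n → Mat n
  (A ⊗ B) i j = Σ[< _ ] (λ k → A i k * B k j)
  infixl 7 _⊗_

  _⊖_ : ∀ {n} → Mat n → Mat n → Mat n
  (A ⊖ B) i j = A i j - B i j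
  infixl 6 _⊖_

  𝟎 : ∀ {n} → Mat n
  𝟎 i j = 0#

  _≈ᴹ_ : ∀ {n} → Mat n → Mat n → Set ℓ
  A ≈ᴹ B = ∀ i j → A i j ≈ B i j
  infix 4 _≈ᴹ_

  𝐉 : ∀ {n} → ℕ → Mat n
  𝐉 p i j = if does (i ≟ j)
              then (if does (toℕ i <? p) then 1# else - 1#)
              else 0#

  In𝒥 : ∀ {n} → ℕ → Mat n → Set ℓ
  In𝒥 p X = (X ᵀ) ⊗ 𝐉 p ⊗ X ≈ᴹ 𝐉 p

  IsSymmetric : ∀ {n} → Mat n → Set ℓ
  IsSymmetric A = A ≈ᴹ A ᵀ

  -- Critical point (paper's definition): ∃ symmetric Λ with ∇f(X) − J X Λ = 0
  IsCritical : ∀ {n} → ℕ → (∇f : Mat n → Mat n) → Mat n → Set (c ⊔ ℓ)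
  IsCritical p ∇f X =
    Σ (Mat _) λ Λ → IsSymmetric Λ × (∇f X ⊖ 𝐉 p ⊗ X ⊗ Λ ≈ᴹ 𝟎)

  ∇𝒥 : ∀ {n} → ℕ → (∇f : Mat n → Mat n) → Mat n → Mat n
  ∇𝒥 p ∇f X = ∇f X ⊖ 𝐉 p ⊗ X ⊗ (∇f X) ᵀ ⊗ X ⊗ 𝐉 p

{-# OPTIONS --safe #-}
module Submission where

-- Only three properties of 𝐉 enter: 𝐉ᵀ = 𝐉, 𝐉𝐉 = I, and Xᵀ𝐉X = 𝐉, which makes 𝐉Xᵀ a left
-- inverse of 𝐉X. Hence G = 𝐉XΛ forces Λ = 𝐉XᵀG, and for symmetric Λ transposing gives
-- Gᵀ = ΛXᵀ𝐉, whence 𝐉XGᵀX𝐉 = 𝐉XΛ(Xᵀ𝐉X)𝐉 = G and XGᵀ𝐉 = XΛXᵀ is symmetric. Conversely,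
-- G = 𝐉XGᵀX𝐉 exhibits the multiplier GᵀX𝐉, symmetric since it equals 𝐉XᵀG; and symmetry
-- of XGᵀ𝐉 = 𝐉GXᵀ rewrites 𝐉XGᵀX𝐉 as GXᵀ𝐉X𝐉 = G. Nothing beyond associativity and
-- (AB)ᵀ = BᵀAᵀ is used, so the argument runs in any semigroup with an anti-involution.

open import Defs
open import Level using (Level)
open import Data.Bool using (Bool; true; false; if_then_else_)
open import Data.Nat using (ℕ; _≤_; zero; suc; _<?_)
open import Data.Fin using (Fin; zero; suc; toℕ; _≟_)
open import Data.Product using (Σ; _×_; _,_; map₂)
open import Data.Empty using (⊥-elim)
open import Function using (_∘_)
open import Function.Bundles using (Equivalence; _⇔_; mk⇔)
import Function.Properties.Equivalence as ⇔
open import Algebra.Bundles using (Semigroup; CommutativeRing)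
open import Relation.Nullary using (does; yes; no)
open import Relation.Binary.PropositionalEquality as ≡ using (_≡_)
import Relation.Binary.Reasoning.Setoid as SetoidReasoning
import Algebra.Properties.Ring as RingProperties
import Algebra.Properties.Semiring.Sum as SemiringSum
import Data.Vec.Functional.Relation.Binary.Equality.Setoid as Pointwise

module _ {a ℓ} (S : Semigroup a ℓ) where
  open Semigroup S

  module JOrthogonal
    (_ᵀ : Carrier → Carrier)
    (ᵀ-cong : ∀ {x y} → x ≈ y → x ᵀ ≈ y ᵀ)
    (ᵀ-involutive : ∀ x → x ᵀ ᵀ ≈ x)
    (ᵀ-anti : ∀ x y → (x ∙ y) ᵀ ≈ y ᵀ ∙ x ᵀ)
    (J : Carrier) (J-symmetric : J ᵀ ≈ J) (J-cancelˡ : ∀ x → J ∙ (J ∙ x) ≈ x)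
    (X : Carrier) (X-J-orthogonal : X ᵀ ∙ J ∙ X ≈ J)
    where

    open SetoidReasoning setoid

    IsSymmetric : Carrier → Set ℓ
    IsSymmetric x = x ≈ x ᵀ

    IsSymmetric-resp : ∀ {x y} → x ≈ y → IsSymmetric y → IsSymmetric x
    IsSymmetric-resp x≈y y≈yᵀ = trans x≈y (trans y≈yᵀ (ᵀ-cong (sym x≈y)))

    ᵀ-injective : ∀ {x y} → x ᵀ ≈ y ᵀ → x ≈ y
    ᵀ-injective {x} {y} xᵀ≈yᵀ = begin
      x      ≈⟨ ᵀ-involutive x ⟨
      x ᵀ ᵀ  ≈⟨ ᵀ-cong xᵀ≈yᵀ ⟩
      y ᵀ ᵀ  ≈⟨ ᵀ-involutive y ⟩
      y      ∎

    J-cancelʳ : ∀ x → x ∙ J ∙ J ≈ x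
    J-cancelʳ x = ᵀ-injective (begin
      (x ∙ J ∙ J) ᵀ        ≈⟨ ᵀ-anti (x ∙ J) J ⟩
      J ᵀ ∙ (x ∙ J) ᵀ      ≈⟨ ∙-cong J-symmetric (ᵀ-anti x J) ⟩
      J ∙ (J ᵀ ∙ x ᵀ)      ≈⟨ ∙-congˡ (∙-congʳ J-symmetric) ⟩
      J ∙ (J ∙ x ᵀ)        ≈⟨ J-cancelˡ (x ᵀ) ⟩
      x ᵀ                  ∎)

    JX-ᵀ : (J ∙ X) ᵀ ≈ X ᵀ ∙ J
    JX-ᵀ = trans (ᵀ-anti J X) (∙-congˡ J-symmetric)

    JXᵀ-cancel-JX : ∀ y → J ∙ X ᵀ ∙ (J ∙ X ∙ y) ≈ y
    JXᵀ-cancel-JX y = begin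
      J ∙ X ᵀ ∙ (J ∙ X ∙ y)      ≈⟨ assoc J (X ᵀ) (J ∙ X ∙ y) ⟩
      J ∙ (X ᵀ ∙ (J ∙ X ∙ y))    ≈⟨ ∙-congˡ (∙-congˡ (assoc J X y)) ⟩
      J ∙ (X ᵀ ∙ (J ∙ (X ∙ y)))  ≈⟨ ∙-congˡ (sym (assoc (X ᵀ) J (X ∙ y))) ⟩
      J ∙ (X ᵀ ∙ J ∙ (X ∙ y))    ≈⟨ ∙-congˡ (sym (assoc (X ᵀ ∙ J) X y)) ⟩
      J ∙ (X ᵀ ∙ J ∙ X ∙ y)      ≈⟨ ∙-congˡ (∙-congʳ X-J-orthogonal) ⟩
      J ∙ (J ∙ y)                ≈⟨ J-cancelˡ y ⟩
      y                          ∎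

    XᵀJX-J-cancel : ∀ y → y ∙ (X ᵀ ∙ J) ∙ X ∙ J ≈ y
    XᵀJX-J-cancel y = begin
      y ∙ (X ᵀ ∙ J) ∙ X ∙ J    ≈⟨ ∙-congʳ (assoc y (X ᵀ ∙ J) X) ⟩
      y ∙ (X ᵀ ∙ J ∙ X) ∙ J    ≈⟨ ∙-congʳ (∙-congˡ X-J-orthogonal) ⟩
      y ∙ J ∙ J                ≈⟨ J-cancelʳ y ⟩
      y                        ∎

    congruent-symmetric : ∀ y {x} → IsSymmetric x → IsSymmetric (y ∙ x ∙ y ᵀ)
    congruent-symmetric y {x} x≈xᵀ = sym (begin
      (y ∙ x ∙ y ᵀ) ᵀ        ≈⟨ ᵀ-anti (y ∙ x) (y ᵀ) ⟩
      y ᵀ ᵀ ∙ (y ∙ x) ᵀ      ≈⟨ ∙-cong (ᵀ-involutive y) (ᵀ-anti y x) ⟩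
      y ∙ (x ᵀ ∙ y ᵀ)        ≈⟨ ∙-congˡ (∙-congʳ x≈xᵀ) ⟨
      y ∙ (x ∙ y ᵀ)          ≈⟨ assoc y x (y ᵀ) ⟨
      y ∙ x ∙ y ᵀ            ∎)

    module _ (G : Carrier) where

      IsMultiplier : Carrier → Set ℓ
      IsMultiplier Λ = G ≈ J ∙ X ∙ Λ

      Critical : Set (a Level.⊔ ℓ)
      Critical = Σ Carrier λ Λ → IsSymmetric Λ × IsMultiplier Λ

      multiplier-unique : ∀ {Λ} → IsMultiplier Λ → Λ ≈ J ∙ X ᵀ ∙ G
      multiplier-unique {Λ} G≈JXΛ = begin
        Λ                      ≈⟨ JXᵀ-cancel-JX Λ ⟨
        J ∙ X ᵀ ∙ (J ∙ X ∙ Λ)  ≈⟨ ∙-congˡ G≈JXΛ ⟨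
        J ∙ X ᵀ ∙ G            ∎

      symmetric-multiplier⇒Gᵀ≈ΛXᵀJ : ∀ {Λ} → IsSymmetric Λ → IsMultiplier Λ → G ᵀ ≈ Λ ∙ (X ᵀ ∙ J)
      symmetric-multiplier⇒Gᵀ≈ΛXᵀJ {Λ} Λ≈Λᵀ G≈JXΛ = begin
        G ᵀ                ≈⟨ ᵀ-cong G≈JXΛ ⟩
        (J ∙ X ∙ Λ) ᵀ      ≈⟨ ᵀ-anti (J ∙ X) Λ ⟩
        Λ ᵀ ∙ (J ∙ X) ᵀ    ≈⟨ ∙-cong (sym Λ≈Λᵀ) JX-ᵀ ⟩
        Λ ∙ (X ᵀ ∙ J)      ∎

      critical⇒G≈JXGᵀXJ : Critical → G ≈ J ∙ X ∙ G ᵀ ∙ X ∙ J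
      critical⇒G≈JXGᵀXJ (Λ , Λ≈Λᵀ , G≈JXΛ) = sym (begin
        J ∙ X ∙ G ᵀ ∙ X ∙ J                ≈⟨ ∙-congʳ (∙-congʳ (∙-congˡ (symmetric-multiplier⇒Gᵀ≈ΛXᵀJ Λ≈Λᵀ G≈JXΛ))) ⟩
        J ∙ X ∙ (Λ ∙ (X ᵀ ∙ J)) ∙ X ∙ J    ≈⟨ ∙-congʳ (∙-congʳ (sym (assoc (J ∙ X) Λ (X ᵀ ∙ J)))) ⟩
        J ∙ X ∙ Λ ∙ (X ᵀ ∙ J) ∙ X ∙ J      ≈⟨ XᵀJX-J-cancel (J ∙ X ∙ Λ) ⟩
        J ∙ X ∙ Λ                          ≈⟨ G≈JXΛ ⟨
        G                                  ∎)

      G≈JXGᵀXJ⇒critical : G ≈ J ∙ X ∙ G ᵀ ∙ X ∙ J → Critical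
      G≈JXGᵀXJ⇒critical G≈JXGᵀXJ = Λ , Λ≈Λᵀ , G≈JXΛ
        where
        Λ : Carrier
        Λ = G ᵀ ∙ X ∙ J
        G≈JXΛ : IsMultiplier Λ
        G≈JXΛ = trans G≈JXGᵀXJ (trans (∙-congʳ (assoc (J ∙ X) (G ᵀ) X)) (assoc (J ∙ X) (G ᵀ ∙ X) J))
        Λ≈Λᵀ : IsSymmetric Λ
        Λ≈Λᵀ = begin
          Λ                    ≈⟨ multiplier-unique G≈JXΛ ⟩
          J ∙ X ᵀ ∙ G          ≈⟨ assoc J (X ᵀ) G ⟩
          J ∙ (X ᵀ ∙ G)        ≈⟨ ∙-cong J-symmetric (∙-congˡ (ᵀ-involutive G)) ⟨
          J ᵀ ∙ (X ᵀ ∙ G ᵀ ᵀ)  ≈⟨ ∙-congˡ (ᵀ-anti (G ᵀ) X) ⟨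
          J ᵀ ∙ (G ᵀ ∙ X) ᵀ    ≈⟨ ᵀ-anti (G ᵀ ∙ X) J ⟨
          Λ ᵀ                  ∎

      critical⇔G≈JXGᵀXJ : Critical ⇔ (G ≈ J ∙ X ∙ G ᵀ ∙ X ∙ J)
      critical⇔G≈JXGᵀXJ = mk⇔ critical⇒G≈JXGᵀXJ G≈JXGᵀXJ⇒critical

      critical⇒JXᵀG-symmetric-multiplier :
        Critical → IsSymmetric (J ∙ X ᵀ ∙ G) × IsMultiplier (J ∙ X ᵀ ∙ G)
      critical⇒JXᵀG-symmetric-multiplier (Λ , Λ≈Λᵀ , G≈JXΛ) =
        IsSymmetric-resp (sym Λ≈JXᵀG) Λ≈Λᵀ , trans G≈JXΛ (∙-congˡ Λ≈JXᵀG)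
        where
        Λ≈JXᵀG : Λ ≈ J ∙ X ᵀ ∙ G
        Λ≈JXᵀG = multiplier-unique G≈JXΛ

      critical⇒XGᵀJ-symmetric : Critical → IsSymmetric (X ∙ G ᵀ ∙ J)
      critical⇒XGᵀJ-symmetric (Λ , Λ≈Λᵀ , G≈JXΛ) =
        IsSymmetric-resp XGᵀJ≈XΛXᵀ (congruent-symmetric X Λ≈Λᵀ)
        where
        XGᵀJ≈XΛXᵀ : X ∙ G ᵀ ∙ J ≈ X ∙ Λ ∙ X ᵀ
        XGᵀJ≈XΛXᵀ = begin
          X ∙ G ᵀ ∙ J              ≈⟨ ∙-congʳ (∙-congˡ (symmetric-multiplier⇒Gᵀ≈ΛXᵀJ Λ≈Λᵀ G≈JXΛ)) ⟩
          X ∙ (Λ ∙ (X ᵀ ∙ J)) ∙ J  ≈⟨ ∙-congʳ (assoc X Λ (X ᵀ ∙ J)) ⟨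
          X ∙ Λ ∙ (X ᵀ ∙ J) ∙ J    ≈⟨ ∙-congʳ (assoc (X ∙ Λ) (X ᵀ) J) ⟨
          X ∙ Λ ∙ X ᵀ ∙ J ∙ J      ≈⟨ J-cancelʳ (X ∙ Λ ∙ X ᵀ) ⟩
          X ∙ Λ ∙ X ᵀ              ∎

      XGᵀJ-symmetric⇒G≈JXGᵀXJ : IsSymmetric (X ∙ G ᵀ ∙ J) → G ≈ J ∙ X ∙ G ᵀ ∙ X ∙ J
      XGᵀJ-symmetric⇒G≈JXGᵀXJ XGᵀJ≈[XGᵀJ]ᵀ = sym (begin
        J ∙ X ∙ G ᵀ ∙ X ∙ J    ≈⟨ ∙-congʳ (∙-congʳ JXGᵀ≈GXᵀJ) ⟩
        G ∙ (X ᵀ ∙ J) ∙ X ∙ J  ≈⟨ XᵀJX-J-cancel G ⟩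
        G                      ∎)
        where
        XGᵀJ≈JGXᵀ : X ∙ G ᵀ ∙ J ≈ J ∙ (G ∙ X ᵀ)
        XGᵀJ≈JGXᵀ = begin
          X ∙ G ᵀ ∙ J          ≈⟨ XGᵀJ≈[XGᵀJ]ᵀ ⟩
          (X ∙ G ᵀ ∙ J) ᵀ      ≈⟨ ᵀ-anti (X ∙ G ᵀ) J ⟩
          J ᵀ ∙ (X ∙ G ᵀ) ᵀ    ≈⟨ ∙-cong J-symmetric (ᵀ-anti X (G ᵀ)) ⟩
          J ∙ (G ᵀ ᵀ ∙ X ᵀ)    ≈⟨ ∙-congˡ (∙-congʳ (ᵀ-involutive G)) ⟩
          J ∙ (G ∙ X ᵀ)        ∎
        JXGᵀ≈GXᵀJ : J ∙ X ∙ G ᵀ ≈ G ∙ (X ᵀ ∙ J)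
        JXGᵀ≈GXᵀJ = begin
          J ∙ X ∙ G ᵀ              ≈⟨ J-cancelʳ (J ∙ X ∙ G ᵀ) ⟨
          J ∙ X ∙ G ᵀ ∙ J ∙ J      ≈⟨ ∙-congʳ (trans (∙-congʳ (assoc J X (G ᵀ))) (assoc J (X ∙ G ᵀ) J)) ⟩
          J ∙ (X ∙ G ᵀ ∙ J) ∙ J    ≈⟨ ∙-congʳ (∙-congˡ XGᵀJ≈JGXᵀ) ⟩
          J ∙ (J ∙ (G ∙ X ᵀ)) ∙ J  ≈⟨ ∙-congʳ (J-cancelˡ (G ∙ X ᵀ)) ⟩
          G ∙ X ᵀ ∙ J              ≈⟨ assoc G (X ᵀ) J ⟩
          G ∙ (X ᵀ ∙ J)            ∎

      critical⇔XGᵀJ-symmetric : Critical ⇔ IsSymmetric (X ∙ G ᵀ ∙ J)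
      critical⇔XGᵀJ-symmetric = mk⇔ critical⇒XGᵀJ-symmetric (G≈JXGᵀXJ⇒critical ∘ XGᵀJ-symmetric⇒G≈JXGᵀXJ)

module MatrixProperties {c ℓ} (R : CommutativeRing c ℓ) where
  open CommutativeRing R hiding (zero)
  open MatrixOps R
  open SemiringSum semiring using (sum; sum-cong-≋; sum-cong-≗; sum-replicate-zero; ∑-comm; *-distribˡ-sum; *-distribʳ-sum)
  open RingProperties ring using (-1*x≈-x; -‿involutive; x∙y⁻¹≈ε⇒x≈y; x≈y⇒x∙y⁻¹≈ε)
  open SetoidReasoning setoid

  Σ≡sum : ∀ {n} (v : Fin n → Carrier) → Σ[< n ] v ≡ sum v
  Σ≡sum {zero} v = ≡.refl
  Σ≡sum {suc n} v = ≡.cong (v zero +_) (Σ≡sum (v ∘ suc))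

  Σ-cong : ∀ {n} {u v : Fin n → Carrier} → (∀ k → u k ≈ v k) → Σ[< n ] u ≈ Σ[< n ] v
  Σ-cong {n} {u} {v} u≈v = begin
    Σ[< n ] u  ≡⟨ Σ≡sum u ⟩
    sum u      ≈⟨ sum-cong-≋ u≈v ⟩
    sum v      ≡⟨ Σ≡sum v ⟨
    Σ[< n ] v  ∎

  sum-zero : ∀ {n} {v : Fin n → Carrier} → (∀ k → v k ≈ 0#) → sum v ≈ 0#
  sum-zero {n} v≈0 = trans (sum-cong-≋ v≈0) (sum-replicate-zero n)

  sum-select : ∀ {n} (i : Fin n) x (v : Fin n → Carrier) →
               sum (λ k → (if does (i ≟ k) then x else 0#) * v k) ≈ x * v i
  sum-select zero x v =
    trans (+-congˡ (sum-zero (λ k → zeroˡ (v (suc k))))) (+-identityʳ (x * v zero))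
  sum-select (suc i) x v =
    trans (+-congʳ (zeroˡ (v zero))) (trans (+-identityˡ _) (sum-select i x (v ∘ suc)))

  ⊗≡sum : ∀ {n} (A B : Mat n) i j → (A ⊗ B) i j ≡ sum (λ k → A i k * B k j)
  ⊗≡sum A B i j = Σ≡sum (λ k → A i k * B k j)

  ⊗-cong : ∀ {n} {A B C D : Mat n} → A ≈ᴹ B → C ≈ᴹ D → A ⊗ C ≈ᴹ B ⊗ D
  ⊗-cong A≈B C≈D i j = Σ-cong (λ k → *-cong (A≈B i k) (C≈D k j))

  ⊗-assoc : ∀ {n} (A B C : Mat n) → A ⊗ B ⊗ C ≈ᴹ A ⊗ (B ⊗ C)
  ⊗-assoc A B C i j = begin
    (A ⊗ B ⊗ C) i j                                  ≡⟨ ⊗≡sum (A ⊗ B) C i j ⟩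
    sum (λ k → (A ⊗ B) i k * C k j)                  ≡⟨ sum-cong-≗ (λ k → ≡.cong (_* C k j) (⊗≡sum A B i k)) ⟩
    sum (λ k → sum (λ l → A i l * B l k) * C k j)    ≈⟨ sum-cong-≋ (λ k → *-distribʳ-sum (C k j) (λ l → A i l * B l k)) ⟩
    sum (λ k → sum (λ l → A i l * B l k * C k j))    ≈⟨ ∑-comm (λ k l → A i l * B l k * C k j) ⟩
    sum (λ l → sum (λ k → A i l * B l k * C k j))    ≈⟨ sum-cong-≋ (λ l → sum-cong-≋ (λ k → *-assoc (A i l) (B l k) (C k j))) ⟩
    sum (λ l → sum (λ k → A i l * (B l k * C k j)))  ≈⟨ sum-cong-≋ (λ l → *-distribˡ-sum (A i l) (λ k → B l k * C k j)) ⟨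
    sum (λ l → A i l * sum (λ k → B l k * C k j))    ≡⟨ sum-cong-≗ (λ l → ≡.cong (A i l *_) (⊗≡sum B C l j)) ⟨
    sum (λ l → A i l * (B ⊗ C) l j)                  ≡⟨ ⊗≡sum A (B ⊗ C) i j ⟨
    (A ⊗ (B ⊗ C)) i j                                ∎

  ⊗-semigroup : ℕ → Semigroup c ℓ
  ⊗-semigroup n = record
    { Carrier = Mat n
    ; _≈_ = _≈ᴹ_
    ; _∙_ = _⊗_
    ; isSemigroup = record
      { isMagma = record
        { isEquivalence = Pointwise.≋-isEquivalence (Pointwise.≋-setoid setoid n) n
        ; ∙-cong = ⊗-cong
        }
      ; assoc = ⊗-assoc
      }
    }

  ᵀ-cong : ∀ {n} {A B : Mat n} → A ≈ᴹ B → A ᵀ ≈ᴹ B ᵀ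
  ᵀ-cong A≈B i j = A≈B j i

  ᵀ-involutive : ∀ {n} (A : Mat n) → A ᵀ ᵀ ≈ᴹ A
  ᵀ-involutive A i j = refl

  ⊗-ᵀ : ∀ {n} (A B : Mat n) → (A ⊗ B) ᵀ ≈ᴹ B ᵀ ⊗ A ᵀ
  ⊗-ᵀ A B i j = Σ-cong (λ k → *-comm (A j k) (B k i))

  diag : ∀ {n} → (Fin n → Carrier) → Mat n
  diag d i j = if does (i ≟ j) then d i else 0#

  diag-ᵀ : ∀ {n} (d : Fin n → Carrier) → diag d ᵀ ≈ᴹ diag d
  diag-ᵀ d i j with i ≟ j | j ≟ i
  ... | yes ≡.refl | yes _      = refl
  ... | yes ≡.refl | no j≢i    = ⊥-elim (j≢i ≡.refl)
  ... | no i≢j     | yes ≡.refl = ⊥-elim (i≢j ≡.refl)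
  ... | no _       | no _      = refl

  diag-⊗ : ∀ {n} (d : Fin n → Carrier) (A : Mat n) → diag d ⊗ A ≈ᴹ (λ i j → d i * A i j)
  diag-⊗ d A i j = trans (reflexive (⊗≡sum (diag d) A i j)) (sum-select i (d i) (λ k → A k j))

  diag-cancelˡ : ∀ {n} {d : Fin n → Carrier} → (∀ i → d i * d i ≈ 1#) →
                 ∀ A → diag d ⊗ (diag d ⊗ A) ≈ᴹ A
  diag-cancelˡ {d = d} d²≈1 A i j = begin
    (diag d ⊗ (diag d ⊗ A)) i j  ≈⟨ diag-⊗ d (diag d ⊗ A) i j ⟩
    d i * (diag d ⊗ A) i j       ≈⟨ *-congˡ (diag-⊗ d A i j) ⟩
    d i * (d i * A i j)          ≈⟨ *-assoc (d i) (d i) (A i j) ⟨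
    d i * d i * A i j            ≈⟨ *-congʳ (d²≈1 i) ⟩
    1# * A i j                   ≈⟨ *-identityˡ (A i j) ⟩
    A i j                        ∎

  sign : Bool → Carrier
  sign b = if b then 1# else - 1#

  sign*sign≈1 : ∀ b → sign b * sign b ≈ 1#
  sign*sign≈1 true  = *-identityˡ 1#
  sign*sign≈1 false = trans (-1*x≈-x (- 1#)) (-‿involutive 1#)

  𝐉-ᵀ : ∀ {n} p → 𝐉 {n} p ᵀ ≈ᴹ 𝐉 p
  𝐉-ᵀ p = diag-ᵀ (λ i → sign (does (toℕ i <? p)))

  𝐉-cancelˡ : ∀ {n} p (A : Mat n) → 𝐉 p ⊗ (𝐉 p ⊗ A) ≈ᴹ A
  𝐉-cancelˡ p = diag-cancelˡ (λ i → sign*sign≈1 (does (toℕ i <? p)))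

  ⊖≈𝟎⇔≈ : ∀ {n} {A B : Mat n} → A ⊖ B ≈ᴹ 𝟎 ⇔ A ≈ᴹ B
  ⊖≈𝟎⇔≈ = mk⇔ (λ A⊖B≈𝟎 i j → x∙y⁻¹≈ε⇒x≈y _ _ (A⊖B≈𝟎 i j)) (λ A≈B i j → x≈y⇒x∙y⁻¹≈ε (A≈B i j))

  module 𝐉-Orthogonal {n} p (X : Mat n) (X∈𝒥 : In𝒥 p X) where
    open JOrthogonal (⊗-semigroup n) _ᵀ ᵀ-cong ᵀ-involutive ⊗-ᵀ
                     (𝐉 p) (𝐉-ᵀ p) (𝐉-cancelˡ p) X X∈𝒥 public

    isCritical⇔critical : ∀ ∇f → IsCritical p ∇f X ⇔ Critical (∇f X)
    isCritical⇔critical ∇f =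
      mk⇔ (map₂ (map₂ (Equivalence.to ⊖≈𝟎⇔≈))) (map₂ (map₂ (Equivalence.from ⊖≈𝟎⇔≈)))

lemma5 : ∀ {c ℓ : Level} (R : CommutativeRing c ℓ) → let open MatrixOps R in
    (n p : ℕ) → p ≤ n → (∇f : Mat n → Mat n) → (X : Mat n) → In𝒥 p X →
      -- (a) critical ⇔ ∇_𝒥 f(X) = 0
      (IsCritical p ∇f X ⇔ (∇𝒥 p ∇f X ≈ᴹ 𝟎))
      -- (a) the multiplier is Λ = J Xᵀ ∇f(X): at a critical point it is a valid
      --     symmetric multiplier, and every multiplier equals it
      × (IsCritical p ∇f X →
           IsSymmetric (𝐉 p ⊗ X ᵀ ⊗ ∇f X)
           × (∇f X ⊖ 𝐉 p ⊗ X ⊗ (𝐉 p ⊗ X ᵀ ⊗ ∇f X) ≈ᴹ 𝟎))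
      × (∀ (Λ : Mat n) → IsSymmetric Λ → (∇f X ⊖ 𝐉 p ⊗ X ⊗ Λ ≈ᴹ 𝟎) →
           Λ ≈ᴹ 𝐉 p ⊗ X ᵀ ⊗ ∇f X)
      -- (b) critical ⇔ X Gᵀ J symmetric, G = ∇f(X)
      × (IsCritical p ∇f X ⇔ IsSymmetric (X ⊗ (∇f X) ᵀ ⊗ 𝐉 p))
lemma5 R n p _ ∇f X X∈𝒥 =
    ⇔.trans (isCritical⇔critical ∇f) (⇔.trans (critical⇔G≈JXGᵀXJ (∇f X)) (⇔.sym ⊖≈𝟎⇔≈))
  , (λ critical → map₂ (Equivalence.from ⊖≈𝟎⇔≈)
       (critical⇒JXᵀG-symmetric-multiplier (∇f X) (Equivalence.to (isCritical⇔critical ∇f) critical)))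
  , (λ Λ _ ∇f⊖JXΛ≈𝟎 → multiplier-unique (∇f X) (Equivalence.to ⊖≈𝟎⇔≈ ∇f⊖JXΛ≈𝟎))
  , ⇔.trans (isCritical⇔critical ∇f) (critical⇔XGᵀJ-symmetric (∇f X))
  where
  open MatrixProperties R
  open 𝐉-Orthogonal p X X∈𝒥
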